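{- Let $p$ be a prime. A minimal polynomial expression of $\operatorname{argmax}^{(0)}(x_0,x_1)$ on $\mathbb{F}_p{}^2$ is \[ \operatorname{argmax}^{(0)}(x_0,x_1)=\sum_{d=1}^{p-1}d^{ -1}(x_0+1)(x_0+2)\cdots(x_0+d)\;x_1(x_1-1)\cdots(x_1-(p-d)+1), \] where $d^{ -1}$ denotes the inverse of $d$ in $\mathbb{F}_p$.
   Context: $\mathbb{F}_p$ is identified with $\{0,1,\dots,p-1\}$ with the usual ordering. $\operatorname{argmax}(x_0,x_1)$ is the least index $i\in\{0,1\}$ with $x_i=\max(x_0,x_1)$, i.e. it equals $1$ if $x_0<x_1$ and $0$ otherwise; $\operatorname{argmax}^{(0)}$ is this value viewed in $\mathbb{F}_p$. A minimal polynomial expression is a polynomial over $\mathbb{F}_p$ of degree at most $p-1$ in each variable coinciding with the function on all inputs. -}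

module Defs where

open import Data.Nat as ℕ using (ℕ; zero; suc; _<ᵇ_)
open import Data.Bool using (if_then_else_)
open import Data.Fin using (Fin; toℕ)
open import Data.Integer using (ℤ; +_; _+_; _-_; _*_; 0ℤ; 1ℤ)
import Data.Integer.Divisibility as ℤDiv

-- Congruence modulo p in ℤ: a ≡ b (mod p)  iff  p ∣ (a - b).
-- Elements of 𝔽_p are represented by integers; equality in 𝔽_p is this congruence.
_≡_[mod_] : ℤ → ℤ → ℕ → Set
a ≡ b [mod p ] = (+ p) ℤDiv.∣ (a - b)

-- 𝔽_p = {0,…,p-1} is represented by Fin p, with the usual ordering of toℕ.
-- argmax(x₀,x₁) = 1 if x₀ < x₁, and 0 otherwise; argmax⁽⁰⁾ viewed in 𝔽_p (as an integer).
argmax⁰ : {p : ℕ} → Fin p → Fin p → ℤ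
argmax⁰ x₀ x₁ = if toℕ x₀ <ᵇ toℕ x₁ then 1ℤ else 0ℤ

rising : ℤ → ℕ → ℤ
rising x zero    = 1ℤ
rising x (suc d) = rising x d * (x + + suc d)

falling : ℤ → ℕ → ℤ
falling x zero    = 1ℤ
falling x (suc k) = falling x k * (x - + k)

sum1to : ℕ → (ℕ → ℤ) → ℤ
sum1to zero    f = 0ℤ
sum1to (suc n) f = sum1to n f + f (suc n)

-- The right-hand side  Σ_{d=1}^{p-1} d⁻¹ (x₀+1)⋯(x₀+d) · x₁(x₁-1)⋯(x₁-(p-d)+1),
-- where inv d is (a representative of) the inverse of d in 𝔽_p.
argmaxPoly : (p : ℕ) → (ℕ → ℤ) → ℤ → ℤ → ℤ
argmaxPoly p inv x₀ x₁ =
  sum1to (p ℕ.∸ 1) (λ d → inv d * rising x₀ d * falling x₁ (p ℕ.∸ d))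

{-# OPTIONS --safe #-}
-- Let q = p − 1, write P(x,y) for the sum and T_d(x,y) for its d-th summand.  Since
-- (x+2)⋯(x+d+1) − (x+1)⋯(x+d) = d·(x+2)⋯(x+d), and dually for the falling factorial, the
-- discrete Leibniz rule together with d⁻¹·d ≡ 1 and d⁻¹·(p−d) ≡ −1 turns T_d(x+1,y+1) − T_d(x,y)
-- into g(d−1) − g(d) with g(d) = (x+2)⋯(x+d+1) · y(y−1)⋯(y−q+d+1).  Telescoping gives
--   P(x+1,y+1) − P(x,y) ≡ y(y−1)⋯(y−q+1) − (x+2)⋯(x+p),
-- and for 0 ≤ x, y < q both terms vanish mod p (the second has the factor p), so P is constant
-- along the diagonals of {0,…,q}².  P vanishes on the edge y = 0 and on the line x = −1, and the
-- step from (−1,c) to (0,c+1), c < q, adds −q! ≡ 1 by Wilson's theorem.  Wilson's theorem follows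
-- by pairing each 1 < k < q with its inverse, which differs from k since only ±1 square to 1.
module Submission where

open import Defs
open import Data.Nat using (ℕ; _≤_; _∸_)
open import Data.Nat.Primality using (Prime)
open import Data.Fin using (Fin; toℕ)
open import Data.Integer using (ℤ; +_; _*_; 1ℤ)

open import Data.Bool using (Bool; true; false; if_then_else_; T; _∧_)
open import Data.Bool.Properties using (T-∧; T-≡)
open import Data.Empty using (⊥-elim)
open import Data.Fin.Properties using (toℕ<n)
open import Data.Integer using (_+_; _-_; -_; 0ℤ; -1ℤ; ∣_∣)
open import Data.Integer.Divisibility.Signed
  using (_∣_; divides; ∣⇒∣ᵤ; ∣ᵤ⇒∣; ∣m⇒∣-m; ∣m∣n⇒∣m+n; ∣n⇒∣m*n; ∣m⇒∣m*n)
open import Data.Integer.DivMod using (_%ℕ_; _/ℕ_; a≡a%ℕn+[a/ℕn]*n; n%ℕd<d)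
import Data.Integer.Properties as ℤ
open import Data.Integer.Tactic.RingSolver using (solve-∀)
open import Data.Nat as ℕ using (zero; suc; _<_; _<ᵇ_; z≤n; s≤s)
import Data.Nat.Divisibility as ℕ
open import Data.Nat.Primality using (euclidsLemma; prime⇒nonTrivial)
import Data.Nat.Properties as ℕ
open import Data.Product as Product using (_×_; _,_)
open import Data.Sum as Sum using (_⊎_; inj₁; inj₂; [_,_]′)
open import Function using (Equivalence; case_of_; _∘_)
open import Level using (0ℓ)
open import Relation.Binary.Bundles using (Setoid)
import Relation.Binary.Reasoning.Setoid as SetoidReasoning
open import Relation.Binary.PropositionalEquality
open import Relation.Nullary using (¬_; yes; no)

sum1to-zero : ∀ n {f : ℕ → ℤ} → (∀ e → e < n → f (suc e) ≡ 0ℤ) → sum1to n f ≡ 0ℤ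
sum1to-zero zero    _   = refl
sum1to-zero (suc n) {f} f≡0 =
  cong₂ _+_ (sum1to-zero n {f} (λ e e<n → f≡0 e (ℕ.m<n⇒m<1+n e<n))) (f≡0 n ℕ.≤-refl)

sum1to-difference : ∀ n (f g : ℕ → ℤ) → sum1to n f - sum1to n g ≡ sum1to n (λ d → f d - g d)
sum1to-difference zero    f g = refl
sum1to-difference (suc n) f g = begin
  (sum1to n f + f (suc n)) - (sum1to n g + g (suc n))   ≡⟨ regroup (sum1to n f) (f (suc n)) (sum1to n g) (g (suc n)) ⟩
  (sum1to n f - sum1to n g) + (f (suc n) - g (suc n))   ≡⟨ cong (_+ (f (suc n) - g (suc n))) (sum1to-difference n f g) ⟩
  sum1to n (λ d → f d - g d) + (f (suc n) - g (suc n))  ∎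
  where
  open ≡-Reasoning
  regroup : ∀ a b c d → (a + b) - (c + d) ≡ (a - c) + (b - d)
  regroup = solve-∀

sum1to-telescope : ∀ n (g : ℕ → ℤ) → sum1to n (λ d → g (d ∸ 1) - g d) ≡ g 0 - g n
sum1to-telescope zero    g = sym (ℤ.+-inverseʳ (g 0))
sum1to-telescope (suc n) g = trans (cong (_+ (g n - g (suc n))) (sum1to-telescope n g)) (cancel (g 0) (g n) (g (suc n)))
  where
  cancel : ∀ a b c → (a - b) + (b - c) ≡ a - c
  cancel = solve-∀

rising-shift : ∀ x d → rising x (suc d) ≡ (1ℤ + x) * rising (1ℤ + x) d
rising-shift x zero    = identity x
  where
  identity : ∀ x → 1ℤ * (x + 1ℤ) ≡ (1ℤ + x) * 1ℤ
  identity = solve-∀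
rising-shift x (suc d) = trans (cong (_* (x + + suc (suc d))) (rising-shift x d)) (identity x (rising (1ℤ + x) d) (+ suc d))
  where
  identity : ∀ x r n → (1ℤ + x) * r * (x + (1ℤ + n)) ≡ (1ℤ + x) * (r * ((1ℤ + x) + n))
  identity = solve-∀

rising-difference : ∀ x d → rising (1ℤ + x) (suc d) - rising x (suc d) ≡ + suc d * rising (1ℤ + x) d
rising-difference x d = trans (cong (λ r → rising (1ℤ + x) (suc d) - r) (rising-shift x d)) (identity x (rising (1ℤ + x) d) (+ suc d))
  where
  identity : ∀ x r n → r * ((1ℤ + x) + n) - (1ℤ + x) * r ≡ n * r
  identity = solve-∀

falling-shift : ∀ y k → falling (1ℤ + y) (suc k) ≡ (1ℤ + y) * falling y k
falling-shift y zero    = identity y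
  where
  identity : ∀ y → 1ℤ * ((1ℤ + y) - 0ℤ) ≡ (1ℤ + y) * 1ℤ
  identity = solve-∀
falling-shift y (suc k) = trans (cong (_* ((1ℤ + y) - + suc k)) (falling-shift y k)) (identity y (falling y k) (+ k))
  where
  identity : ∀ y r n → (1ℤ + y) * r * ((1ℤ + y) - (1ℤ + n)) ≡ (1ℤ + y) * (r * (y - n))
  identity = solve-∀

falling-difference : ∀ y k → falling (1ℤ + y) (suc k) - falling y (suc k) ≡ + suc k * falling y k
falling-difference y k = trans (cong (_- falling y (suc k)) (falling-shift y k)) (identity y (falling y k) (+ k))
  where
  identity : ∀ y r n → (1ℤ + y) * r - r * (y - n) ≡ (1ℤ + n) * r
  identity = solve-∀

falling-vanishes : ∀ {n k} → n < k → falling (+ n) k ≡ 0ℤ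
falling-vanishes {n} {suc k} (s≤s n≤k) with n ℕ.≟ k
... | yes refl = trans (cong (falling (+ n) n *_) (ℤ.+-inverseʳ (+ n))) (ℤ.*-zeroʳ (falling (+ n) n))
... | no  n≢k  = trans (cong (_* (+ n - + k)) (falling-vanishes (ℕ.≤∧≢⇒< n≤k n≢k))) (ℤ.*-zeroˡ (+ n - + k))

rising-vanishes-at-minus-one : ∀ d → rising -1ℤ (suc d) ≡ 0ℤ
rising-vanishes-at-minus-one d = trans (rising-shift -1ℤ d) (ℤ.*-zeroˡ (rising 0ℤ d))

rising-divisible : ∀ {m x} d → x < m → m ≤ x ℕ.+ d → + m ∣ rising (+ x) d
rising-divisible {m} {x} zero    x<m m≤x+0 = ⊥-elim (ℕ.<⇒≱ x<m (subst (m ≤_) (ℕ.+-identityʳ x) m≤x+0))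
rising-divisible {m} {x} (suc d) x<m m≤x+d+1 with m ℕ.≟ x ℕ.+ suc d
... | yes refl = ∣n⇒∣m*n (rising (+ x) d) (divides 1ℤ (sym (ℤ.*-identityˡ _)))
... | no  m≢x+d+1 = ∣m⇒∣m*n (+ x + + suc d) (rising-divisible d x<m m≤x+d)
  where
  m≤x+d : m ≤ x ℕ.+ d
  m≤x+d = ℕ.<⇒≤pred (subst (m <_) (ℕ.+-suc x d) (ℕ.≤∧≢⇒< m≤x+d+1 m≢x+d+1))

∏ : (ℕ → Bool) → ℕ → ℤ
∏ s zero    = 1ℤ
∏ s (suc n) = ∏ s n * (if s (suc n) then + suc n else 1ℤ)

remove : ℕ → (ℕ → Bool) → ℕ → Bool
remove j s k with k ℕ.≟ j
... | yes _ = false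
... | no  _ = s k

remove-≡ : ∀ j s → remove j s j ≡ false
remove-≡ j s with j ℕ.≟ j
... | yes _   = refl
... | no  j≢j = ⊥-elim (j≢j refl)

remove-≢ : ∀ {j k} s → k ≢ j → remove j s k ≡ s k
remove-≢ {j} {k} s k≢j with k ℕ.≟ j
... | yes k≡j = ⊥-elim (k≢j k≡j)
... | no  _   = refl

∏-cong : ∀ n {s t : ℕ → Bool} → (∀ e → e < n → s (suc e) ≡ t (suc e)) → ∏ s n ≡ ∏ t n
∏-cong zero    _   = refl
∏-cong (suc n) {s} {t} s≡t =
  cong₂ (λ r b → r * (if b then + suc n else 1ℤ)) (∏-cong n (λ e e<n → s≡t e (ℕ.m<n⇒m<1+n e<n))) (s≡t n ℕ.≤-refl)

∏-remove : ∀ n s {k} → 1 ≤ k → k ≤ n → s k ≡ true → ∏ s n ≡ + k * ∏ (remove k s) n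
∏-remove zero    s (s≤s _) ()
∏-remove (suc n) s {k} 1≤k k≤n+1 sk with k ℕ.≟ suc n
... | yes refl rewrite sk | remove-≡ k s = begin
  ∏ s n * + k                    ≡⟨ ℤ.*-comm (∏ s n) (+ k) ⟩
  + k * ∏ s n                    ≡⟨ cong (+ k *_) (∏-cong n (λ e e<n → remove-≢ s (ℕ.<⇒≢ (s≤s e<n)))) ⟨
  + k * ∏ (remove k s) n         ≡⟨ cong (+ k *_) (ℤ.*-identityʳ _) ⟨
  + k * (∏ (remove k s) n * 1ℤ)  ∎
  where open ≡-Reasoning
... | no  k≢n+1 = begin
  ∏ s n * factor (s (suc n))                                   ≡⟨ cong (_* factor (s (suc n))) (∏-remove n s 1≤k k≤n sk) ⟩
  + k * ∏ (remove k s) n * factor (s (suc n))                  ≡⟨ ℤ.*-assoc (+ k) _ _ ⟩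
  + k * (∏ (remove k s) n * factor (s (suc n)))                ≡⟨ cong (λ b → + k * (∏ (remove k s) n * factor b)) (remove-≢ s (k≢n+1 ∘ sym)) ⟨
  + k * (∏ (remove k s) n * factor (remove k s (suc n)))       ∎
  where
  open ≡-Reasoning
  factor : Bool → ℤ
  factor b = if b then + suc n else 1ℤ
  k≤n : k ≤ n
  k≤n = ℕ.≤-pred (ℕ.≤∧≢⇒< k≤n+1 k≢n+1)

∣∧<⇒≡0 : ∀ {m n} → m ℕ.∣ n → n < m → n ≡ 0
∣∧<⇒≡0 {n = zero}  _   _   = refl
∣∧<⇒≡0 {n = suc n} m∣n n<m = ⊥-elim (ℕ.>⇒∤ n<m m∣n)

module Congruence (m : ℕ) where

  infix 4 _≈_

  record _≈_ (a b : ℤ) : Set where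
    constructor mk
    field modulus∣difference : + m ∣ a - b

  ≈-by : ∀ {a b c} → c ≡ a - b → + m ∣ c → a ≈ b
  ≈-by refl m∣c = mk m∣c

  ∣⇒≈0 : ∀ {a} → + m ∣ a → a ≈ 0ℤ
  ∣⇒≈0 {a} = ≈-by (sym (ℤ.+-identityʳ a))

  ≈-refl : ∀ {a} → a ≈ a
  ≈-refl {a} = ≈-by (sym (ℤ.+-inverseʳ a)) (divides 0ℤ refl)

  ≈-reflexive : ∀ {a b} → a ≡ b → a ≈ b
  ≈-reflexive refl = ≈-refl

  ≈-sym : ∀ {a b} → a ≈ b → b ≈ a
  ≈-sym {a} {b} (mk m∣a-b) = ≈-by (identity a b) (∣m⇒∣-m m∣a-b)
    where
    identity : ∀ a b → - (a - b) ≡ b - a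
    identity = solve-∀

  ≈-trans : ∀ {a b c} → a ≈ b → b ≈ c → a ≈ c
  ≈-trans {a} {b} {c} (mk m∣a-b) (mk m∣b-c) = ≈-by (identity a b c) (∣m∣n⇒∣m+n m∣a-b m∣b-c)
    where
    identity : ∀ a b c → (a - b) + (b - c) ≡ a - c
    identity = solve-∀

  +-cong : ∀ {a b c d} → a ≈ b → c ≈ d → a + c ≈ b + d
  +-cong {a} {b} {c} {d} (mk m∣a-b) (mk m∣c-d) = ≈-by (identity a b c d) (∣m∣n⇒∣m+n m∣a-b m∣c-d)
    where
    identity : ∀ a b c d → (a - b) + (c - d) ≡ (a + c) - (b + d)
    identity = solve-∀

  *-cong : ∀ {a b c d} → a ≈ b → c ≈ d → a * c ≈ b * d
  *-cong {a} {b} {c} {d} (mk m∣a-b) (mk m∣c-d) =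
    ≈-by (identity a b c d) (∣m∣n⇒∣m+n (∣n⇒∣m*n a m∣c-d) (∣m⇒∣m*n d m∣a-b))
    where
    identity : ∀ a b c d → a * (c - d) + (a - b) * d ≡ a * c - b * d
    identity = solve-∀

  +-congˡ : ∀ a {b c} → b ≈ c → a + b ≈ a + c
  +-congˡ a = +-cong (≈-refl {a})

  *-congˡ : ∀ a {b c} → b ≈ c → a * b ≈ a * c
  *-congˡ a = *-cong (≈-refl {a})

  *-congʳ : ∀ c {a b} → a ≈ b → a * c ≈ b * c
  *-congʳ c a≈b = *-cong a≈b (≈-refl {c})

  -‿cong : ∀ {a b} → a ≈ b → - a ≈ - b
  -‿cong {a} {b} (mk m∣a-b) = ≈-by (identity a b) (∣m⇒∣-m m∣a-b)
    where
    identity : ∀ a b → - (a - b) ≡ - a - - b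
    identity = solve-∀

  ≈-setoid : Setoid 0ℓ 0ℓ
  ≈-setoid = record
    { Carrier       = ℤ
    ; _≈_           = _≈_
    ; isEquivalence = record { refl = ≈-refl ; sym = ≈-sym ; trans = ≈-trans }
    }

  module ≈-Reasoning = SetoidReasoning ≈-setoid

  modulus≈0 : + m ≈ 0ℤ
  modulus≈0 = ∣⇒≈0 (divides 1ℤ (sym (ℤ.*-identityˡ (+ m))))

  ∸-inverse : ∀ {d i} → d ≤ m → + d * i ≈ 1ℤ → + (m ∸ d) * i ≈ -1ℤ
  ∸-inverse {d} {i} d≤m d*i≈1 = begin
    + (m ∸ d) * i       ≡⟨ cong (_* i) (sym (trans (ℤ.m-n≡m⊖n m d) (ℤ.⊖-≥ d≤m))) ⟩
    (+ m - + d) * i     ≡⟨ distribute (+ m) (+ d) i ⟩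
    + m * i - + d * i   ≈⟨ +-cong (*-congʳ i modulus≈0) (-‿cong d*i≈1) ⟩
    0ℤ * i - 1ℤ         ≡⟨ cong (_- 1ℤ) (ℤ.*-zeroˡ i) ⟩
    -1ℤ                 ∎
    where
    open ≈-Reasoning
    distribute : ∀ a b c → (a - b) * c ≡ a * c - b * c
    distribute = solve-∀

  sum1to-cong : ∀ n {f g : ℕ → ℤ} → (∀ e → e < n → f (suc e) ≈ g (suc e)) → sum1to n f ≈ sum1to n g
  sum1to-cong zero    _   = ≈-refl
  sum1to-cong (suc n) f≈g = +-cong (sum1to-cong n (λ e e<n → f≈g e (ℕ.m<n⇒m<1+n e<n))) (f≈g n ℕ.≤-refl)

  ≈⇒≡-≥ : ∀ {j k} → k ≤ j → j < m → + j ≈ + k → j ≡ k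
  ≈⇒≡-≥ {j} {k} k≤j j<m (mk m∣j-k) =
    ℕ.≤-antisym (ℕ.m∸n≡0⇒m≤n (∣∧<⇒≡0 m∣j∸k (ℕ.≤-<-trans (ℕ.m∸n≤m j k) j<m))) k≤j
    where
    m∣j∸k : m ℕ.∣ j ∸ k
    m∣j∸k = ∣⇒∣ᵤ (subst (+ m ∣_) (trans (ℤ.m-n≡m⊖n j k) (ℤ.⊖-≥ k≤j)) m∣j-k)

  ≈⇒≡ : ∀ {j k} → j < m → k < m → + j ≈ + k → j ≡ k
  ≈⇒≡ {j} {k} j<m k<m j≈k with ℕ.≤-total k j
  ... | inj₁ k≤j = ≈⇒≡-≥ k≤j j<m j≈k
  ... | inj₂ j≤k = sym (≈⇒≡-≥ j≤k k<m (≈-sym j≈k))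

  ≈0⇒∣ : ∀ {a} → a ≈ 0ℤ → + m ∣ a
  ≈0⇒∣ {a} (mk m∣a-0) = subst (+ m ∣_) (ℤ.+-identityʳ a) m∣a-0

  -≈0⇒≈ : ∀ {a b} → a - b ≈ 0ℤ → a ≈ b
  -≈0⇒≈ a-b≈0 = mk (≈0⇒∣ a-b≈0)

  -≈⇒≈+ : ∀ {a b c} → a - b ≈ c → a ≈ b + c
  -≈⇒≈+ {a} {b} {c} (mk m∣a-b-c) = ≈-by (identity a b c) m∣a-b-c
    where
    identity : ∀ a b c → (a - b) - c ≡ a - (b + c)
    identity = solve-∀

  pred-modulus≈-1 : ∀ {n} → suc n ≡ m → + n ≈ -1ℤ
  pred-modulus≈-1 {n} refl = ≈-by (identity (+ n)) (divides 1ℤ (sym (ℤ.*-identityˡ (+ m))))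
    where
    identity : ∀ a → 1ℤ + a ≡ a - -1ℤ
    identity = solve-∀

  record Partner (σ : ℕ → ℕ) (s : ℕ → Bool) (n k : ℕ) : Set where
    field
      partner∈       : s (σ k) ≡ true
      1≤partner      : 1 ≤ σ k
      partner≤       : σ k ≤ n
      partner≢       : σ k ≢ k
      involutive     : σ (σ k) ≡ k
      partner-inverse : + k * + σ k ≈ 1ℤ

  InvolutivePairing : (ℕ → ℕ) → (ℕ → Bool) → ℕ → Set
  InvolutivePairing σ s n = ∀ k → 1 ≤ k → k ≤ n → s k ≡ true → Partner σ s n k

  module _ {σ : ℕ → ℕ} where

    Partner-narrow : ∀ {s n k} → Partner σ s (suc n) k → σ k ≢ suc n → Partner σ s n k
    Partner-narrow partner σk≢n+1 = record
      { partner∈        = partner∈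
      ; 1≤partner       = 1≤partner
      ; partner≤        = ℕ.≤-pred (ℕ.≤∧≢⇒< partner≤ σk≢n+1)
      ; partner≢        = partner≢
      ; involutive      = involutive
      ; partner-inverse = partner-inverse
      }
      where open Partner partner

    Partner-remove : ∀ {s n j k} → Partner σ s n k → σ k ≢ j → Partner σ (remove j s) n k
    Partner-remove {s} partner σk≢j = record
      { partner∈        = trans (remove-≢ s σk≢j) partner∈
      ; 1≤partner       = 1≤partner
      ; partner≤        = partner≤
      ; partner≢        = partner≢
      ; involutive      = involutive
      ; partner-inverse = partner-inverse
      }
      where open Partner partner

    ∏-paired≈1 : ∀ n s → InvolutivePairing σ s n → ∏ s n ≈ 1ℤ
    ∏-paired≈1 zero    s _     = ≈-refl
    ∏-paired≈1 (suc n) s pairs with s (suc n) in s[n+1]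
    ... | false = ≈-trans (≈-reflexive (ℤ.*-identityʳ (∏ s n))) (∏-paired≈1 n s pairs′)
      where
      pairs′ : InvolutivePairing σ s n
      pairs′ k 1≤k k≤n sk = Partner-narrow partner σk≢n+1
        where
        partner : Partner σ s (suc n) k
        partner = pairs k 1≤k (ℕ.m≤n⇒m≤1+n k≤n) sk
        σk≢n+1 : σ k ≢ suc n
        σk≢n+1 σk≡n+1 = case (trans (sym (subst (λ i → s i ≡ true) σk≡n+1 (Partner.partner∈ partner))) s[n+1]) of λ ()
    ... | true  = begin
      ∏ s n * + suc n                    ≡⟨ cong (_* + suc n) (∏-remove n s (Partner.1≤partner top) j≤n (Partner.partner∈ top)) ⟩
      + j * ∏ (remove j s) n * + suc n   ≈⟨ *-congʳ (+ suc n) (*-congˡ (+ j) (∏-paired≈1 n (remove j s) pairs′)) ⟩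
      + j * 1ℤ * + suc n                 ≡⟨ rearrange (+ j) (+ suc n) ⟩
      + suc n * + j                      ≈⟨ Partner.partner-inverse top ⟩
      1ℤ                                 ∎
      where
      open ≈-Reasoning
      j : ℕ
      j = σ (suc n)
      top : Partner σ s (suc n) (suc n)
      top = pairs (suc n) (s≤s z≤n) ℕ.≤-refl s[n+1]
      j≤n : j ≤ n
      j≤n = ℕ.≤-pred (ℕ.≤∧≢⇒< (Partner.partner≤ top) (Partner.partner≢ top))
      rearrange : ∀ a b → a * 1ℤ * b ≡ b * a
      rearrange = solve-∀
      pairs′ : InvolutivePairing σ (remove j s) n
      pairs′ k 1≤k k≤n tk = Partner-narrow (Partner-remove partner σk≢j) σk≢n+1
        where
        k≢j : k ≢ j
        k≢j refl = case trans (sym tk) (remove-≡ j s) of λ ()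
        partner : Partner σ s (suc n) k
        partner = pairs k 1≤k (ℕ.m≤n⇒m≤1+n k≤n) (trans (sym (remove-≢ s k≢j)) tk)
        σk≢j : σ k ≢ j
        σk≢j σk≡j = ℕ.<⇒≢ (s≤s k≤n) (trans (sym (Partner.involutive partner)) (trans (cong σ σk≡j) (Partner.involutive top)))
        σk≢n+1 : σ k ≢ suc n
        σk≢n+1 σk≡n+1 = k≢j (trans (sym (Partner.involutive partner)) (cong σ σk≡n+1))

module PrimeModulus {q : ℕ} (prime : Prime (suc q)) where

  open Congruence (suc q)

  p : ℕ
  p = suc q

  1<p : 1 < p
  1<p = ℕ.nonTrivial⇒n>1 p {{prime⇒nonTrivial prime}}

  1≉0 : ¬ 1ℤ ≈ 0ℤ
  1≉0 1≈0 = case ≈⇒≡ 1<p (ℕ.<-trans ℕ.z<s 1<p) 1≈0 of λ ()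

  a*b≈0⇒a≈0⊎b≈0 : ∀ a b → a * b ≈ 0ℤ → a ≈ 0ℤ ⊎ b ≈ 0ℤ
  a*b≈0⇒a≈0⊎b≈0 a b ab≈0 =
    Sum.map (∣⇒≈0 ∘ ∣ᵤ⇒∣) (∣⇒≈0 ∘ ∣ᵤ⇒∣) (euclidsLemma ∣ a ∣ ∣ b ∣ prime p∣∣a∣∣b∣)
    where
    p∣∣a∣∣b∣ : p ℕ.∣ ∣ a ∣ ℕ.* ∣ b ∣
    p∣∣a∣∣b∣ = subst (p ℕ.∣_) (ℤ.abs-* a b) (∣⇒∣ᵤ (≈0⇒∣ ab≈0))

  inverse-unique : ∀ k {j l} → j < p → l < p → + k * + j ≈ 1ℤ → + k * + l ≈ 1ℤ → j ≡ l
  inverse-unique k {j} {l} j<p l<p kj≈1 kl≈1 =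
    [ (λ k≈0 → ⊥-elim (1≉0 (≈-trans (≈-sym kj≈1) (*-congʳ (+ j) k≈0))))
    , (λ j-l≈0 → ≈⇒≡ j<p l<p (-≈0⇒≈ j-l≈0))
    ]′ (a*b≈0⇒a≈0⊎b≈0 (+ k) (+ j - + l) k[j-l]≈0)
    where
    open ≈-Reasoning
    distribute : ∀ a b c → a * (b - c) ≡ a * b - a * c
    distribute = solve-∀
    k[j-l]≈0 : + k * (+ j - + l) ≈ 0ℤ
    k[j-l]≈0 = begin
      + k * (+ j - + l)       ≡⟨ distribute (+ k) (+ j) (+ l) ⟩
      + k * + j - + k * + l   ≈⟨ +-cong kj≈1 (-‿cong kl≈1) ⟩
      1ℤ - 1ℤ                 ∎

  1≤q : 1 ≤ q
  1≤q = ℕ.≤-pred 1<p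

  1+pred[q]≡q : suc (ℕ.pred q) ≡ q
  1+pred[q]≡q = ℕ.suc-pred q {{ℕ.>-nonZero 1≤q}}

  self-inverse : ∀ {k} → k < p → + k * + k ≈ 1ℤ → k ≡ 1 ⊎ k ≡ q
  self-inverse {k} k<p kk≈1 =
    Sum.map (λ k-1≈0 → ≈⇒≡ k<p 1<p (-≈0⇒≈ k-1≈0))
            (λ k+1≈0 → ≈⇒≡ k<p ℕ.≤-refl (≈-trans (mk (≈0⇒∣ k+1≈0)) (≈-sym (pred-modulus≈-1 refl))))
            (a*b≈0⇒a≈0⊎b≈0 (+ k - 1ℤ) (+ k + 1ℤ) [k-1][k+1]≈0)
    where
    open ≈-Reasoning
    difference-of-squares : ∀ a → (a - 1ℤ) * (a + 1ℤ) ≡ a * a - 1ℤ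
    difference-of-squares = solve-∀
    [k-1][k+1]≈0 : (+ k - 1ℤ) * (+ k + 1ℤ) ≈ 0ℤ
    [k-1][k+1]≈0 = begin
      (+ k - 1ℤ) * (+ k + 1ℤ)  ≡⟨ difference-of-squares (+ k) ⟩
      + k * + k - 1ℤ           ≈⟨ +-cong kk≈1 ≈-refl ⟩
      1ℤ - 1ℤ                  ∎

  middle : ℕ → Bool
  middle k = (1 <ᵇ k) ∧ (k <ᵇ q)

  middle-intro : ∀ {k} → 1 < k → k < q → middle k ≡ true
  middle-intro 1<k k<q = Equivalence.to T-≡ (Equivalence.from T-∧ (ℕ.<⇒<ᵇ 1<k , ℕ.<⇒<ᵇ k<q))

  middle-elim : ∀ {k} → middle k ≡ true → 1 < k × k < q
  middle-elim {k} middle[k] = Product.map (ℕ.<ᵇ⇒< 1 k) (ℕ.<ᵇ⇒< k q) (Equivalence.to T-∧ (Equivalence.from T-≡ middle[k]))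

  ∏-middle : ∀ n → n < q → ∏ middle n ≡ rising 0ℤ n
  ∏-middle zero          _     = refl
  ∏-middle (suc zero)    _     = refl
  ∏-middle (suc (suc n)) n+2<q =
    cong₂ (λ r b → r * (if b then + suc (suc n) else 1ℤ)) (∏-middle (suc n) (ℕ.<⇒≤ n+2<q)) (middle-intro (s≤s (s≤s z≤n)) n+2<q)

  module _ (inv : ℕ → ℤ) (inv-correct : ∀ d → 1 ≤ d → d ≤ q → + d * inv d ≈ 1ℤ) where

    σ : ℕ → ℕ
    σ k = inv k %ℕ p

    σ<p : ∀ k → σ k < p
    σ<p k = n%ℕd<d (inv k) p

    σ≤q : ∀ k → σ k ≤ q
    σ≤q k = ℕ.≤-pred (σ<p k)

    inv≈σ : ∀ k → inv k ≈ + σ k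
    inv≈σ k = ≈-by quotient*p≡inv-σ (divides (inv k /ℕ p) refl)
      where
      cancel : ∀ r t → (r + t) - r ≡ t
      cancel = solve-∀
      quotient*p≡inv-σ : (inv k /ℕ p) * + p ≡ inv k - + σ k
      quotient*p≡inv-σ = trans (sym (cancel (+ σ k) _)) (cong (_- + σ k) (sym (a≡a%ℕn+[a/ℕn]*n (inv k) p)))

    σ-inverse : ∀ {k} → 1 ≤ k → k ≤ q → + k * + σ k ≈ 1ℤ
    σ-inverse {k} 1≤k k≤q = ≈-trans (*-congˡ (+ k) (≈-sym (inv≈σ k))) (inv-correct k 1≤k k≤q)

    σ-positive : ∀ {k} → 1 ≤ k → k ≤ q → 1 ≤ σ k
    σ-positive {k} 1≤k k≤q = ℕ.n≢0⇒n>0 λ σk≡0 →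
      1≉0 (≈-trans (≈-sym (σ-inverse 1≤k k≤q)) (≈-reflexive (trans (cong (λ j → + k * + j) σk≡0) (ℤ.*-zeroʳ (+ k)))))

    σ-involutive : ∀ {k} → 1 ≤ k → k ≤ q → σ (σ k) ≡ k
    σ-involutive {k} 1≤k k≤q = inverse-unique (σ k) (σ<p (σ k)) (s≤s k≤q)
      (σ-inverse (σ-positive 1≤k k≤q) (σ≤q k))
      (≈-trans (≈-reflexive (ℤ.*-comm (+ σ k) (+ k))) (σ-inverse 1≤k k≤q))

    σ-fixes-1 : σ 1 ≡ 1
    σ-fixes-1 = inverse-unique 1 (σ<p 1) 1<p (σ-inverse ℕ.≤-refl 1≤q) ≈-refl

    σ-fixes-q : σ q ≡ q
    σ-fixes-q = inverse-unique q (σ<p q) ℕ.≤-refl (σ-inverse 1≤q ℕ.≤-refl) (*-cong q≈-1 q≈-1)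
      where
      q≈-1 : + q ≈ -1ℤ
      q≈-1 = pred-modulus≈-1 refl

    middle-pairing : InvolutivePairing σ middle (ℕ.pred q)
    middle-pairing k 1≤k _ middle[k] with middle-elim middle[k]
    ... | 1<k , k<q = record
      { partner∈        = middle-intro 1<σk σk<q
      ; 1≤partner       = σ-positive 1≤k k≤q
      ; partner≤        = ℕ.<⇒≤pred σk<q
      ; partner≢        = σk≢k
      ; involutive      = σ-involutive 1≤k k≤q
      ; partner-inverse = σ-inverse 1≤k k≤q
      }
      where
      k≤q : k ≤ q
      k≤q = ℕ.<⇒≤ k<q
      σσk≡k : σ (σ k) ≡ k
      σσk≡k = σ-involutive 1≤k k≤q
      σk≢1 : σ k ≢ 1
      σk≢1 σk≡1 = ℕ.<⇒≢ 1<k (trans (sym σ-fixes-1) (trans (cong σ (sym σk≡1)) σσk≡k))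
      σk≢q : σ k ≢ q
      σk≢q σk≡q = ℕ.<⇒≢ k<q (trans (sym σσk≡k) (trans (cong σ σk≡q) σ-fixes-q))
      σk≢k : σ k ≢ k
      σk≢k σk≡k = [ ℕ.>⇒≢ 1<k , ℕ.<⇒≢ k<q ]′
        (self-inverse (s≤s k≤q) (subst (λ j → + k * + j ≈ 1ℤ) σk≡k (σ-inverse 1≤k k≤q)))
      1<σk : 1 < σ k
      1<σk = ℕ.≤∧≢⇒< (σ-positive 1≤k k≤q) (σk≢1 ∘ sym)
      σk<q : σ k < q
      σk<q = ℕ.≤∧≢⇒< (σ≤q k) σk≢q

    wilson : rising 0ℤ q ≈ -1ℤ
    wilson = begin
      rising 0ℤ q                              ≡⟨ cong (rising 0ℤ) 1+pred[q]≡q ⟨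
      rising 0ℤ (ℕ.pred q) * + suc (ℕ.pred q)  ≡⟨ cong₂ _*_ (∏-middle (ℕ.pred q) pred[q]<q) (cong +_ (sym 1+pred[q]≡q)) ⟨
      ∏ middle (ℕ.pred q) * + q                ≈⟨ *-cong (∏-paired≈1 (ℕ.pred q) middle middle-pairing) (pred-modulus≈-1 refl) ⟩
      1ℤ * -1ℤ                                 ∎
      where
      open ≈-Reasoning
      pred[q]<q : ℕ.pred q < q
      pred[q]<q = ℕ.≤-reflexive 1+pred[q]≡q

module ArgmaxPolynomial (q : ℕ) (inv : ℕ → ℤ) where

  open Congruence (suc q)

  summand : ℤ → ℤ → ℕ → ℤ
  summand x y d = inv d * rising x d * falling y (suc q ∸ d)

  P : ℤ → ℤ → ℤ
  P = argmaxPoly (suc q) inv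

  P-zeroʳ : ∀ x → P x 0ℤ ≡ 0ℤ
  P-zeroʳ x = sum1to-zero q λ e e<q →
    trans (cong (inv (suc e) * rising x (suc e) *_) (falling-vanishes (ℕ.m<n⇒0<n∸m e<q)))
          (ℤ.*-zeroʳ (inv (suc e) * rising x (suc e)))

  P-minus-oneˡ : ∀ y → P -1ℤ y ≡ 0ℤ
  P-minus-oneˡ y = sum1to-zero q λ e _ →
    trans (cong (λ r → inv (suc e) * r * falling y (q ∸ e)) (rising-vanishes-at-minus-one e)) (vanish (inv (suc e)) _)
    where
    vanish : ∀ i f → i * 0ℤ * f ≡ 0ℤ
    vanish = solve-∀

  summand-step : ∀ x y i e k → + suc e * i ≈ 1ℤ → + suc k * i ≈ -1ℤ →
    i * rising (1ℤ + x) (suc e) * falling (1ℤ + y) (suc k) - i * rising x (suc e) * falling y (suc k)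
      ≈ rising (1ℤ + x) e * falling y (suc k) - rising (1ℤ + x) (suc e) * falling y k
  summand-step x y i e k d*i≈1 n*i≈-1 = begin
    i * A * C - i * B * D                              ≡⟨ leibniz i A B C D ⟩
    i * (A * (C - D) + (A - B) * D)                    ≡⟨ cong₂ (λ u v → i * (A * u + v * D)) (falling-difference y k) (rising-difference x e) ⟩
    i * (A * (+ suc k * G) + (+ suc e * E) * D)        ≡⟨ regroup i A D E G (+ suc k) (+ suc e) ⟩
    (+ suc k * i) * (A * G) + (+ suc e * i) * (E * D)  ≈⟨ +-cong (*-congʳ (A * G) n*i≈-1) (*-congʳ (E * D) d*i≈1) ⟩
    -1ℤ * (A * G) + 1ℤ * (E * D)                       ≡⟨ finish (A * G) (E * D) ⟩
    E * D - A * G                                      ∎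
    where
    open ≈-Reasoning
    A B C D E G : ℤ
    A = rising (1ℤ + x) (suc e)
    B = rising x (suc e)
    C = falling (1ℤ + y) (suc k)
    D = falling y (suc k)
    E = rising (1ℤ + x) e
    G = falling y k
    leibniz : ∀ i a b c d → i * a * c - i * b * d ≡ i * (a * (c - d) + (a - b) * d)
    leibniz = solve-∀
    regroup : ∀ i a d e g n m → i * (a * (n * g) + (m * e) * d) ≡ (n * i) * (a * g) + (m * i) * (e * d)
    regroup = solve-∀
    finish : ∀ u v → -1ℤ * u + 1ℤ * v ≡ v - u
    finish = solve-∀

  module _ (inv-correct : ∀ d → 1 ≤ d → d ≤ q → + d * inv d ≈ 1ℤ) where

    summand-difference : ∀ x y e → e < q →
      summand (1ℤ + x) (1ℤ + y) (suc e) - summand x y (suc e)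
        ≈ rising (1ℤ + x) e * falling y (q ∸ e) - rising (1ℤ + x) (suc e) * falling y (q ∸ suc e)
    -- suc q ∸ suc e reduces to q ∸ e, which +-∸-assoc rewrites to suc (q ∸ suc e).
    summand-difference x y e e<q rewrite ℕ.+-∸-assoc 1 e<q =
      summand-step x y (inv (suc e)) e (q ∸ suc e) (inv-correct (suc e) (s≤s z≤n) e<q) n*i≈-1
      where
      n*i≈-1 : + suc (q ∸ suc e) * inv (suc e) ≈ -1ℤ
      n*i≈-1 = subst (λ n → + n * inv (suc e) ≈ -1ℤ) (ℕ.+-∸-assoc 1 e<q)
                 (∸-inverse (ℕ.m≤n⇒m≤1+n e<q) (inv-correct (suc e) (s≤s z≤n) e<q))

    P-diagonal-step : ∀ x y → P (1ℤ + x) (1ℤ + y) - P x y ≈ falling y q - rising (1ℤ + x) q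
    P-diagonal-step x y = begin
      P (1ℤ + x) (1ℤ + y) - P x y                                 ≡⟨ sum1to-difference q (summand (1ℤ + x) (1ℤ + y)) (summand x y) ⟩
      sum1to q (λ d → summand (1ℤ + x) (1ℤ + y) d - summand x y d) ≈⟨ sum1to-cong q (summand-difference x y) ⟩
      sum1to q (λ d → g (d ∸ 1) - g d)                            ≡⟨ sum1to-telescope q g ⟩
      g 0 - g q                                                   ≡⟨ cong₂ _-_ (ℤ.*-identityˡ (falling y q)) g[q]≡ ⟩
      falling y q - rising (1ℤ + x) q                             ∎
      where
      open ≈-Reasoning
      g : ℕ → ℤ
      g d = rising (1ℤ + x) d * falling y (q ∸ d)
      g[q]≡ : g q ≡ rising (1ℤ + x) q
      g[q]≡ = trans (cong (λ n → rising (1ℤ + x) q * falling y n) (ℕ.n∸n≡0 q)) (ℤ.*-identityʳ _)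

    P-diagonal : ∀ {x y} → x < q → y < q → P (+ suc x) (+ suc y) ≈ P (+ x) (+ y)
    P-diagonal {x} {y} x<q y<q = -≈0⇒≈ (begin
      P (+ suc x) (+ suc y) - P (+ x) (+ y)  ≈⟨ P-diagonal-step (+ x) (+ y) ⟩
      falling (+ y) q - rising (+ suc x) q   ≈⟨ +-cong (≈-reflexive (falling-vanishes y<q)) (-‿cong p∣rising) ⟩
      0ℤ - 0ℤ                                ∎)
      where
      open ≈-Reasoning
      p∣rising : rising (+ suc x) q ≈ 0ℤ
      p∣rising = ∣⇒≈0 (rising-divisible q (s≤s x<q) (s≤s (ℕ.m≤n+m q x)))

    P-diagonal-invariant : ∀ n {x y} → n ≤ x → n ≤ y → x ≤ q → y ≤ q → P (+ x) (+ y) ≈ P (+ (x ∸ n)) (+ (y ∸ n))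
    P-diagonal-invariant zero    _         _         _   _   = ≈-refl
    P-diagonal-invariant (suc n) (s≤s n≤x) (s≤s n≤y) x<q y<q =
      ≈-trans (P-diagonal x<q y<q) (P-diagonal-invariant n n≤x n≤y (ℕ.<⇒≤ x<q) (ℕ.<⇒≤ y<q))

    P-below-diagonal : ∀ {a b} → b ≤ a → a ≤ q → P (+ a) (+ b) ≈ 0ℤ
    P-below-diagonal {a} {b} b≤a a≤q = begin
      P (+ a) (+ b)               ≈⟨ P-diagonal-invariant b b≤a ℕ.≤-refl a≤q (ℕ.≤-trans b≤a a≤q) ⟩
      P (+ (a ∸ b)) (+ (b ∸ b))   ≡⟨ cong (λ n → P (+ (a ∸ b)) (+ n)) (ℕ.n∸n≡0 b) ⟩
      P (+ (a ∸ b)) 0ℤ            ≡⟨ P-zeroʳ (+ (a ∸ b)) ⟩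
      0ℤ                          ∎
      where open ≈-Reasoning

    P-above-diagonal : rising 0ℤ q ≈ -1ℤ → ∀ {a b} → a < b → b ≤ q → P (+ a) (+ b) ≈ 1ℤ
    P-above-diagonal wilson {a} {b} a<b b≤q = begin
      P (+ a) (+ b)                                 ≈⟨ P-diagonal-invariant a ℕ.≤-refl (ℕ.<⇒≤ a<b) (ℕ.≤-trans (ℕ.<⇒≤ a<b) b≤q) b≤q ⟩
      P (+ (a ∸ a)) (+ (b ∸ a))                     ≡⟨ cong₂ (λ u v → P (+ u) (+ v)) (ℕ.n∸n≡0 a) (ℕ.+-∸-assoc 1 a<b) ⟩
      P (1ℤ + -1ℤ) (1ℤ + + c)                       ≈⟨ -≈⇒≈+ (P-diagonal-step -1ℤ (+ c)) ⟩
      P -1ℤ (+ c) + (falling (+ c) q - rising 0ℤ q) ≈⟨ +-cong (≈-reflexive (P-minus-oneˡ (+ c))) increment≈1 ⟩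
      0ℤ + 1ℤ                                       ∎
      where
      open ≈-Reasoning
      c : ℕ
      c = b ∸ suc a
      c<q : c < q
      c<q = ℕ.≤-trans (ℕ.≤-reflexive (sym (ℕ.+-∸-assoc 1 a<b))) (ℕ.≤-trans (ℕ.m∸n≤m b a) b≤q)
      increment≈1 : falling (+ c) q - rising 0ℤ q ≈ 1ℤ
      increment≈1 = +-cong (≈-reflexive (falling-vanishes c<q)) (-‿cong wilson)

    argmax⁰≈P : rising 0ℤ q ≈ -1ℤ → ∀ a b → a ≤ q → b ≤ q → (if a <ᵇ b then 1ℤ else 0ℤ) ≈ P (+ a) (+ b)
    argmax⁰≈P wilson a b a≤q b≤q with a <ᵇ b in a<ᵇb
    ... | true  = ≈-sym (P-above-diagonal wilson (ℕ.<ᵇ⇒< a b (subst T (sym a<ᵇb) _)) b≤q)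
    ... | false = ≈-sym (P-below-diagonal (ℕ.≮⇒≥ (λ a<b → subst T a<ᵇb (ℕ.<⇒<ᵇ a<b))) a≤q)

proposition5p2 : (p : ℕ) → Prime p →
    (inv : ℕ → ℤ) →
    (∀ d → 1 ≤ d → d ≤ p ∸ 1 → ((+ d) * inv d) ≡ 1ℤ [mod p ]) →
    (x₀ x₁ : Fin p) →
    argmax⁰ x₀ x₁ ≡ argmaxPoly p inv (+ toℕ x₀) (+ toℕ x₁) [mod p ]
proposition5p2 zero    _     _   _           ()
proposition5p2 (suc q) prime-p inv inv-correct x₀ x₁ =
  ∣⇒∣ᵤ (_≈_.modulus∣difference
    (argmax⁰≈P inv-inverse wilson (toℕ x₀) (toℕ x₁) (ℕ.≤-pred (toℕ<n x₀)) (ℕ.≤-pred (toℕ<n x₁))))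
  where
  open Congruence (suc q)
  open ArgmaxPolynomial q inv
  inv-inverse : ∀ d → 1 ≤ d → d ≤ q → + d * inv d ≈ 1ℤ
  inv-inverse d 1≤d d≤q = mk (∣ᵤ⇒∣ (inv-correct d 1≤d d≤q))
  wilson : rising 0ℤ q ≈ -1ℤ
  wilson = PrimeModulus.wilson prime-p inv inv-inverse
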